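{- Let $\pi=\pi_1\pi_2\cdots\pi_n$ be a permutation of $\{1,\ldots,n\}$. Let $M=\{\pi_j-i \mid i<j,\ \pi_i>\pi_j\}$ and let $m=\#M$ be the number of distinct elements of $M$. Then there exist at most $m$ permutations $\rho^1,\rho^2,\ldots$ of bandwidth $1$ (i.e. $|\rho^j_i-i|\le 1$ for all $i$) such that $\pi=\rho^1\rho^2\cdots$.
   Context: A permutation $\rho$ of $\{1,\ldots,n\}$ has bandwidth $w$ if $|\rho_i-i|\le w$ for every $i$; equivalently its permutation matrix $P$ (with $P_{i,\rho_i}=1$) has $P_{i,j}=0$ whenever $|i-j|>w$. Bandwidth $1$ permutations are exactly the products of mutually nonadjacent simple transpositions $s_i=(i,i+1)$ (two transpositions $s_i,s_j$ are adjacent if $|i-j|=1$). If $m=0$ the product is empty and $\pi$ is the identity. -}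

module Defs where

open import Data.Nat using (ℕ; _≤_; ∣_-_∣)
open import Data.Integer as ℤ using (ℤ)
open import Data.Fin using (Fin; toℕ)
open import Data.Fin.Permutation using (Permutation′; _⟨$⟩ʳ_; id; _∘ₚ_)
open import Data.List using (List; []; _∷_; length; map; cartesianProduct; allFin; deduplicate; filter)
open import Data.Product using (_,_)
open import Relation.Nullary.Decidable using (_×-dec_)
open import Data.Fin.Properties using (_<?_)

-- π is a permutation of Fin n = {0,…,n-1} (0-indexed version of {1,…,n});
-- π_i is written  π ⟨$⟩ʳ i.

Bandwidth1 : ∀ {n} → Permutation′ n → Set
Bandwidth1 {n} ρ = ∀ (i : Fin n) → ∣ toℕ (ρ ⟨$⟩ʳ i) - toℕ i ∣ ≤ 1

-- Product ρ¹ρ²⋯ρᵏ of a list of permutations (empty product = identity),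
-- composed as functions:  (ρ¹ρ²⋯ρᵏ)(i) = ρ¹(ρ²(⋯ρᵏ(i))).
-- (Note  σ ∘ₚ τ  applies σ first, then τ.)
product : ∀ {n} → List (Permutation′ n) → Permutation′ n
product []       = id
product (ρ ∷ ρs) = product ρs ∘ₚ ρ

-- The list of values  π_j - i  over all inversions (i < j, π_i > π_j),
-- with repetitions.  (Differences are shift-invariant, so 0-indexing is harmless.)
inversionValues : ∀ {n} → Permutation′ n → List ℤ
inversionValues {n} π =
  map (λ { (i , j) → ℤ.+ toℕ (π ⟨$⟩ʳ j) ℤ.- ℤ.+ toℕ i })
    (filter (λ { (i , j) → (i <? j) ×-dec (π ⟨$⟩ʳ j <? π ⟨$⟩ʳ i) })
      (cartesianProduct (allFin n) (allFin n)))

distinctInversionValues : ∀ {n} → Permutation′ n → ℕ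
distinctInversionValues π = length (deduplicate ℤ._≟_ (inversionValues π))

module Submission where

-- Idea: a "sweep".  Shift all positions by n.  The value x starts at position
-- pos x (its place in π), moves right at unit speed and stops at its home x + n;
-- at time d it is at key d x = min (x + n , pos x + d).  Ranking the values by
-- (key, initial position) gives a permutation `arrangement d`, equal to π⁻¹ at time 0
-- and to the identity at time 2n.  From time d to d + 1 a moving value can only
-- overtake the single value already at home at its current position, so every rank
-- changes by at most one: the transition arrangement(d)⁻¹ ; arrangement(d+1) has
-- bandwidth 1.  Such an overtaking is an inversion of π of value d − n, and without
-- one nothing changes.  Telescoping over the times at which the arrangement changes
-- factors π into bandwidth-1 transitions indexed by distinct inversion values.

open import Level using (Level)
open import Function using (_∘_)
open import Function.Definitions using (Injective)
open import Relation.Nullary using (Dec; yes; no; ¬_; ¬?)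
open import Relation.Nullary.Decidable using (_×-dec_)
open import Relation.Unary using (Pred; Decidable)
open import Relation.Binary.Bundles using (StrictTotalOrder)
open import Relation.Binary.Definitions using (tri<; tri≈; tri>)
open import Relation.Binary.PropositionalEquality
open import Data.Empty using (⊥-elim)
open import Data.Unit using (tt)
open import Data.Sum using (_⊎_; inj₁; inj₂)
open import Data.Product using (Σ; _×_; _,_; ∃; ∃₂; proj₁; proj₂)
open import Data.Product.Relation.Binary.Lex.Strict using (×-Lex; ×-strictTotalOrder)
open import Data.Nat as ℕ using (ℕ; zero; suc; _+_; _⊓_; ∣_-_∣; _≤_; _<_; z≤n; s≤s; s≤s⁻¹)
open import Data.Nat.Properties
open import Data.Integer as ℤ using (ℤ; _⊖_)
import Data.Integer.Properties as ℤ
open import Algebra.Properties.AbelianGroup ℤ.+-0-abelianGroup using (∙-cancelʳ)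
open import Data.Fin as Fin using (Fin; toℕ)
import Data.Fin.Properties as FinP
open import Data.Fin.Permutation as Perm
  using (Permutation′; permutation; _⟨$⟩ʳ_; _⟨$⟩ˡ_; inverseˡ; inverseʳ; flip; _∘ₚ_; _≈_)
open import Data.List using (List; map; filter; downFrom; length; lookup; deduplicate)
open import Data.List.Properties using (length-map)
open import Data.List.Relation.Unary.All as All using (All)
import Data.List.Relation.Unary.All.Properties as All
import Data.List.Relation.Unary.Any as Any
open import Data.List.Relation.Unary.Any.Properties using (lookup-index)
open import Data.List.Relation.Unary.AllPairs using (_∷_)
open import Data.List.Relation.Unary.Unique.Propositional using (Unique)
import Data.List.Relation.Unary.Unique.Propositional.Properties as Unique
open import Data.List.Membership.Propositional using (_∈_)
open import Data.List.Membership.Propositional.Properties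
  using (∈-lookup; ∈-map⁺; ∈-filter⁺; ∈-cartesianProduct⁺; ∈-allFin; ∈-deduplicate⁺)
open import Defs

private
  variable
    n : ℕ
    ℓ ℓ′ ℓ″ : Level

indicator : ∀ {a} {A : Set a} → Dec A → ℕ
indicator (yes _) = 1
indicator (no _)  = 0

count : {P : Pred (Fin n) ℓ} → Decidable P → ℕ
count {n = zero}  P? = 0
count {n = suc n} P? = indicator (P? Fin.zero) + count (P? ∘ Fin.suc)

count-cong : {P : Pred (Fin n) ℓ} {Q : Pred (Fin n) ℓ′} (P? : Decidable P) (Q? : Decidable Q) →
             (∀ y → P y → Q y) → (∀ y → Q y → P y) → count P? ≡ count Q?
count-cong {n = zero}  P? Q? to from = refl
count-cong {n = suc n} P? Q? to from with P? Fin.zero | Q? Fin.zero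
... | yes _ | yes _ = cong suc (count-cong _ _ (to ∘ Fin.suc) (from ∘ Fin.suc))
... | no  _ | no  _ = count-cong _ _ (to ∘ Fin.suc) (from ∘ Fin.suc)
... | yes p | no ¬q = ⊥-elim (¬q (to Fin.zero p))
... | no ¬p | yes q = ⊥-elim (¬p (from Fin.zero q))

count-split : {P : Pred (Fin n) ℓ} {Q : Pred (Fin n) ℓ′} {R : Pred (Fin n) ℓ″} (P? : Decidable P) (Q? : Decidable Q) (R? : Decidable R) →
              (∀ y → Q y → P y ⊎ R y) → (∀ y → P y → Q y) → (∀ y → R y → Q y) →
              (∀ y → P y → ¬ R y) → count Q? ≡ count P? + count R?
count-split {n = zero}  P? Q? R? into fromP fromR disj = refl
count-split {n = suc n} P? Q? R? into fromP fromR disj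
  with P? Fin.zero | Q? Fin.zero | R? Fin.zero
     | count-split (P? ∘ Fin.suc) (Q? ∘ Fin.suc) (R? ∘ Fin.suc)
                   (into ∘ Fin.suc) (fromP ∘ Fin.suc) (fromR ∘ Fin.suc) (disj ∘ Fin.suc)
... | yes _ | yes _ | no  _ | ih = cong suc ih
... | no  _ | yes _ | yes _ | ih = trans (cong suc ih) (sym (+-suc _ _))
... | no  _ | no  _ | no  _ | ih = ih
... | yes p | _     | yes r | _  = ⊥-elim (disj Fin.zero p r)
... | yes p | no ¬q | no  _ | _  = ⊥-elim (¬q (fromP Fin.zero p))
... | no  _ | no ¬q | yes r | _  = ⊥-elim (¬q (fromR Fin.zero r))
... | no ¬p | yes q | no ¬r | _  with into Fin.zero q
...   | inj₁ p = ⊥-elim (¬p p)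
...   | inj₂ r = ⊥-elim (¬r r)

count-none : {P : Pred (Fin n) ℓ} (P? : Decidable P) → (∀ y → ¬ P y) → count P? ≡ 0
count-none {n = zero}  P? none = refl
count-none {n = suc n} P? none with P? Fin.zero
... | yes p = ⊥-elim (none Fin.zero p)
... | no  _ = count-none (P? ∘ Fin.suc) (none ∘ Fin.suc)

count-atMostOne : {P : Pred (Fin n) ℓ} (P? : Decidable P) →
                  (∀ y z → P y → P z → y ≡ z) → count P? ≤ 1
count-atMostOne {n = zero}  P? unique = z≤n
count-atMostOne {n = suc n} P? unique with P? Fin.zero
... | yes p = ≤-reflexive (cong suc (count-none (P? ∘ Fin.suc)
                (λ y py → FinP.0≢1+n (unique Fin.zero (Fin.suc y) p py))))
... | no  _ = count-atMostOne (P? ∘ Fin.suc)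
                (λ y z py pz → FinP.suc-injective (unique (Fin.suc y) (Fin.suc z) py pz))

count-some : {P : Pred (Fin n) ℓ} (P? : Decidable P) (x : Fin n) → P x → 1 ≤ count P?
count-some P? Fin.zero    px with P? Fin.zero
... | yes _  = s≤s z≤n
... | no ¬px = ⊥-elim (¬px px)
count-some P? (Fin.suc x) px = ≤-trans (count-some (P? ∘ Fin.suc) x px) (m≤n+m _ _)

count-all : count {n = n} (λ _ → yes tt) ≡ n
count-all {n = zero}  = refl
count-all {n = suc n} = cong suc count-all

count-difference : {P : Pred (Fin n) ℓ} {Q : Pred (Fin n) ℓ′} (P? : Decidable P) (Q? : Decidable Q) →
                   (∀ y → P y → Q y) → count Q? ≡ count P? + count (λ y → Q? y ×-dec ¬? (P? y))
count-difference {P = P} {Q = Q} P? Q? P⊆Q =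
  count-split P? Q? (λ y → Q? y ×-dec ¬? (P? y)) into P⊆Q (λ _ → proj₁) (λ _ p q∖p → proj₂ q∖p p)
  where
  into : ∀ y → Q y → P y ⊎ (Q y × ¬ P y)
  into y qy with P? y
  ... | yes py = inj₁ py
  ... | no ¬py = inj₂ (qy , ¬py)

count-strict : {P : Pred (Fin n) ℓ} {Q : Pred (Fin n) ℓ′} (P? : Decidable P) (Q? : Decidable Q) →
               (∀ y → P y → Q y) → (x : Fin n) → Q x → ¬ P x → count P? < count Q?
count-strict P? Q? P⊆Q x qx ¬px = begin-strict
  count P?                                      <⟨ m<m+n (count P?) (count-some _ x (qx , ¬px)) ⟩
  count P? + count (λ y → Q? y ×-dec ¬? (P? y))  ≡⟨ count-difference P? Q? P⊆Q ⟨
  count Q?                                      ∎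
  where open ≤-Reasoning

Step : ∀ {m} (M : Set m) → ℕ → ℕ → Set m
Step M a b = ∃ λ k → b ≡ a + k × k ≤ 1 × (¬ M → k ≡ 0)

step-≤1 : ∀ {m} {M : Set m} {a b} → Step M a b → ∣ a - b ∣ ≤ 1
step-≤1 {a = a} (k , refl , k≤1 , _) = ≤-trans (≤-reflexive (∣m-m+n∣≡n a k)) k≤1

step-still : ∀ {m} {M : Set m} {a b} → Step M a b → ¬ M → b ≡ a
step-still {a = a} (k , refl , _ , no-step) ¬M = trans (cong (a +_) (no-step ¬M)) (+-identityʳ a)

count-step : ∀ {m} {M : Set m} {P : Pred (Fin n) ℓ} {Q : Pred (Fin n) ℓ′}
             (P? : Decidable P) (Q? : Decidable Q) → (∀ y → P y → Q y) →
             (∀ y z → Q y × ¬ P y → Q z × ¬ P z → y ≡ z) → (∀ y → Q y × ¬ P y → M) →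
             Step M (count P?) (count Q?)
count-step P? Q? P⊆Q unique event =
  _ , count-difference P? Q? P⊆Q , count-atMostOne _ unique , λ ¬M → count-none _ (λ y → ¬M ∘ event y)

permutation-injective : (σ : Permutation′ n) → Injective _≡_ _≡_ (σ ⟨$⟩ʳ_)
permutation-injective σ same = trans (sym (inverseˡ σ)) (trans (cong (σ ⟨$⟩ˡ_) same) (inverseˡ σ))

injective⇒surjective : (f : Fin n → Fin n) → Injective _≡_ _≡_ f → ∀ c → ∃ λ x → f x ≡ c
injective⇒surjective {n = suc n} f f-inj c with FinP.any? (λ x → f x FinP.≟ c)
... | yes hit = hit
... | no miss with FinP.pigeonhole (n<1+n n) (λ x → Fin.punchOut (λ c≡fx → miss (x , sym c≡fx)))
...   | i , j , i<j , same = ⊥-elim (<-irrefl (cong toℕ (f-inj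
          (FinP.punchOut-injective (λ e → miss (i , sym e)) (λ e → miss (j , sym e)) same))) i<j)

injective⇒permutation : (f : Fin n → Fin n) → Injective _≡_ _≡_ f → Permutation′ n
injective⇒permutation f f-inj = permutation f (proj₁ ∘ preimage) (proj₂ ∘ preimage)
                                  (λ x → f-inj (proj₂ (preimage (f x))))
  where
  preimage : ∀ c → ∃ λ x → f x ≡ c
  preimage = injective⇒surjective f f-inj

count-below : (σ : Permutation′ n) → ∀ c → c ≤ n → count (λ y → toℕ (σ ⟨$⟩ʳ y) <? c) ≡ c
count-below σ zero    _   = count-none (λ y → toℕ (σ ⟨$⟩ʳ y) <? zero) (λ _ ())
count-below σ (suc c) c<n = begin
  count (λ y → σ[ y ] <? suc c)                          ≡⟨ count-split _ _ _ below-or-at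
                                                              (λ _ → m<n⇒m<1+n) (λ _ → ≤-reflexive ∘ cong suc)
                                                              (λ _ lt eq → <-irrefl eq lt) ⟩
  count (λ y → σ[ y ] <? c) + count (λ y → σ[ y ] ≟ c)   ≡⟨ cong₂ _+_ (count-below σ c (<⇒≤ c<n)) exactly-one ⟩
  c + 1                                                 ≡⟨ +-comm c 1 ⟩
  suc c                                                 ∎
  where
  open ≡-Reasoning
  σ[_] : Fin _ → ℕ
  σ[ y ] = toℕ (σ ⟨$⟩ʳ y)
  below-or-at : ∀ y → σ[ y ] < suc c → σ[ y ] < c ⊎ σ[ y ] ≡ c
  below-or-at y lt = m≤n⇒m<n∨m≡n (s≤s⁻¹ lt)
  exactly-one : count (λ y → σ[ y ] ≟ c) ≡ 1
  exactly-one = ≤-antisym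
    (count-atMostOne _ (λ y z y↦c z↦c → permutation-injective σ (FinP.toℕ-injective (trans y↦c (sym z↦c)))))
    (count-some _ (σ ⟨$⟩ˡ Fin.fromℕ< c<n) (trans (cong toℕ (inverseʳ σ)) (FinP.toℕ-fromℕ< c<n)))

module Ranking {a ℓ₁ ℓ₂} (S : StrictTotalOrder a ℓ₁ ℓ₂) {n : ℕ} (f : Fin n → StrictTotalOrder.Carrier S)
               (f-inj : ∀ {x y} → StrictTotalOrder._≈_ S (f x) (f y) → x ≡ y) where
  open StrictTotalOrder S using (compare; module Eq)
    renaming (_<_ to _⊏_; _<?_ to _⊏?_; irrefl to ⊏-irrefl; trans to ⊏-trans)

  rank : Fin n → ℕ
  rank x = count (λ y → f y ⊏? f x)

  -- x itself is not counted, so ranks lie in [0, n).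
  rank<n : ∀ x → rank x < n
  rank<n x = subst (rank x <_) count-all
    (count-strict _ (λ _ → yes tt) _ x tt (⊏-irrefl Eq.refl))

  -- Everything below y is below x, and y itself too.
  rank-mono : ∀ {x y} → f y ⊏ f x → rank y < rank x
  rank-mono {x} {y} y<x = count-strict (λ z → f z ⊏? f y) (λ z → f z ⊏? f x)
    (λ _ z<y → ⊏-trans z<y y<x) y y<x (⊏-irrefl Eq.refl)

  -- Distinct keys are comparable, hence have distinct ranks.
  rank-injective : ∀ {x y} → rank x ≡ rank y → x ≡ y
  rank-injective {x} {y} same with compare (f x) (f y)
  ... | tri< x<y _ _ = ⊥-elim (<-irrefl same (rank-mono x<y))
  ... | tri≈ _ x≈y _ = f-inj x≈y
  ... | tri> _ _ y<x = ⊥-elim (<-irrefl (sym same) (rank-mono y<x))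

  rankPerm : Permutation′ n
  rankPerm = injective⇒permutation (λ x → Fin.fromℕ< (rank<n x))
    (λ same → rank-injective (FinP.fromℕ<-injective _ _ (rank<n _) (rank<n _) same))

  toℕ-rankPerm : ∀ x → toℕ (rankPerm ⟨$⟩ʳ x) ≡ rank x
  toℕ-rankPerm x = FinP.toℕ-fromℕ< (rank<n x)

  rank-by-permutation : (σ : Permutation′ n) →
    (∀ x y → f y ⊏ f x → toℕ (σ ⟨$⟩ʳ y) < toℕ (σ ⟨$⟩ʳ x)) →
    (∀ x y → toℕ (σ ⟨$⟩ʳ y) < toℕ (σ ⟨$⟩ʳ x) → f y ⊏ f x) →
    ∀ x → rank x ≡ toℕ (σ ⟨$⟩ʳ x)
  rank-by-permutation σ to from x =
    trans (count-cong _ (λ y → toℕ (σ ⟨$⟩ʳ y) <? toℕ (σ ⟨$⟩ʳ x)) (to x) (from x))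
          (count-below σ (toℕ (σ ⟨$⟩ʳ x)) (<⇒≤ (FinP.toℕ<n _)))

module Telescope {n ℓ} (A : ℕ → Permutation′ n) {C : Pred ℕ ℓ} (C? : Decidable C)
                 (still : ∀ d → ¬ C d → A (suc d) ≈ A d) where

  transition : ℕ → Permutation′ n
  transition d = flip (A d) ∘ₚ A (suc d)

  changeTimes : ℕ → List ℕ
  changeTimes d = filter C? (downFrom d)

  telescope : ∀ d x → product (map transition (changeTimes d)) ⟨$⟩ʳ (A 0 ⟨$⟩ʳ x) ≡ A d ⟨$⟩ʳ x
  telescope zero    x = refl
  telescope (suc d) x with C? d
  ... | yes _ = trans (cong (λ y → A (suc d) ⟨$⟩ʳ (A d ⟨$⟩ˡ y)) (telescope d x))
                      (cong (A (suc d) ⟨$⟩ʳ_) (inverseˡ (A d)))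
  ... | no ¬c = trans (telescope d x) (sym (still d ¬c x))

unique-lookup-injective : ∀ {a} {A : Set a} {xs : List A} → Unique xs →
                          ∀ {i j} → lookup xs i ≡ lookup xs j → i ≡ j
unique-lookup-injective (x∉xs ∷ _)   {Fin.zero}  {Fin.zero}  _  = refl
unique-lookup-injective (x∉xs ∷ _)   {Fin.zero}  {Fin.suc j} eq = ⊥-elim (All.lookup x∉xs (∈-lookup j) eq)
unique-lookup-injective (x∉xs ∷ _)   {Fin.suc i} {Fin.zero}  eq = ⊥-elim (All.lookup x∉xs (∈-lookup i) (sym eq))
unique-lookup-injective (_ ∷ unique) {Fin.suc i} {Fin.suc j} eq = cong Fin.suc (unique-lookup-injective unique eq)

-- A list without duplicates, all of whose entries occur in ys, is no longer than ys:
-- sending each entry to a position where it occurs in ys is injective.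
unique-⊆⇒length≤ : ∀ {a} {A : Set a} {xs ys : List A} → Unique xs → All (_∈ ys) xs → length xs ≤ length ys
unique-⊆⇒length≤ {xs = xs} {ys} unique xs⊆ys = FinP.injective⇒≤ occurrence-injective
  where
  occurrence : Fin (length xs) → Fin (length ys)
  occurrence i = Any.index (All.lookup xs⊆ys (∈-lookup i))
  occurrence-injective : Injective _≡_ _≡_ occurrence
  occurrence-injective {i} {j} same = unique-lookup-injective unique (begin
    lookup xs i                  ≡⟨ lookup-index (All.lookup xs⊆ys (∈-lookup i)) ⟩
    lookup ys (occurrence i)     ≡⟨ cong (lookup ys) same ⟩
    lookup ys (occurrence j)     ≡⟨ lookup-index (All.lookup xs⊆ys (∈-lookup j)) ⟨
    lookup xs j                  ∎)
    where open ≡-Reasoning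

difference-cong : ∀ {a b c e} → a + e ≡ c + b → ℤ.+ a ℤ.- ℤ.+ b ≡ ℤ.+ c ℤ.- ℤ.+ e
difference-cong {a} {b} {c} {e} a+e≡c+b = begin
  ℤ.+ a ℤ.- ℤ.+ b      ≡⟨ ℤ.[+m]-[+n]≡m⊖n a b ⟩
  a ⊖ b                ≡⟨ ℤ.+-cancelˡ-⊖ e a b ⟨
  (e + a) ⊖ (e + b)    ≡⟨ cong₂ _⊖_ (trans (+-comm e a) (trans a+e≡c+b (+-comm c b))) (+-comm e b) ⟩
  (b + c) ⊖ (b + e)    ≡⟨ ℤ.+-cancelˡ-⊖ b c e ⟩
  c ⊖ e                ≡⟨ ℤ.[+m]-[+n]≡m⊖n c e ⟨
  ℤ.+ c ℤ.- ℤ.+ e      ∎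
  where open ≡-Reasoning

_<ₗ_ : ℕ × ℕ → ℕ × ℕ → Set
_<ₗ_ = ×-Lex _≡_ _<_ _<_

ℕ²-lex : StrictTotalOrder _ _ _
ℕ²-lex = ×-strictTotalOrder <-strictTotalOrder <-strictTotalOrder

lex-raise : ∀ {a a′ b q r} → (a , q) <ₗ (b , r) → a′ ≤ suc a → (a′ , q) <ₗ (suc b , r)
lex-raise (inj₁ a<b)        a′≤1+a = inj₁ (≤-<-trans a′≤1+a (s≤s a<b))
lex-raise (inj₂ (refl , q<r)) a′≤1+a with m≤n⇒m<n∨m≡n a′≤1+a
... | inj₁ a′<1+a = inj₁ a′<1+a
... | inj₂ a′≡1+a = inj₂ (a′≡1+a , q<r)

lex-lower : ∀ {a a′ b q r} → (a′ , q) <ₗ (b , r) → a ≤ a′ → (a , q) <ₗ (b , r)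
lex-lower (inj₁ a′<b)          a≤a′ = inj₁ (≤-<-trans a≤a′ a′<b)
lex-lower (inj₂ (refl , q<r)) a≤a′ with m≤n⇒m<n∨m≡n a≤a′
... | inj₁ a<a′ = inj₁ a<a′
... | inj₂ a≡a′ = inj₂ (a≡a′ , q<r)

lex-suc⁻ : ∀ {a b q r} → (suc a , q) <ₗ (suc b , r) → (a , q) <ₗ (b , r)
lex-suc⁻ (inj₁ 1+a<1+b)      = inj₁ (ℕ.s<s⁻¹ 1+a<1+b)
lex-suc⁻ (inj₂ (refl , q<r)) = inj₂ (refl , q<r)

lex-gained : ∀ {a b q r} → (a , q) <ₗ (suc b , r) → ¬ (a , q) <ₗ (b , r) →
             (a ≡ b × ¬ q < r) ⊎ (a ≡ suc b × q < r)
lex-gained (inj₂ (a≡1+b , q<r)) _ = inj₂ (a≡1+b , q<r)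
lex-gained (inj₁ a<1+b) not-below with m≤n⇒m<n∨m≡n (s≤s⁻¹ a<1+b)
... | inj₁ a<b = ⊥-elim (not-below (inj₁ a<b))
... | inj₂ a≡b = inj₁ (a≡b , λ q<r → not-below (inj₂ (a≡b , q<r)))

lex-lost : ∀ {a b q r} → (a , q) <ₗ (b , r) → ¬ (suc a , q) <ₗ (b , r) →
           (a ≡ b × q < r) ⊎ (suc a ≡ b × ¬ q < r)
lex-lost (inj₂ (a≡b , q<r)) _ = inj₁ (a≡b , q<r)
lex-lost (inj₁ a<b) not-below with m≤n⇒m<n∨m≡n a<b
... | inj₁ 1+a<b = ⊥-elim (not-below (inj₁ 1+a<b))
... | inj₂ 1+a≡b = inj₂ (1+a≡b , λ q<r → not-below (inj₂ (1+a≡b , q<r)))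

module Sweep {n : ℕ} (π : Permutation′ n) where

  pos : Fin n → ℕ
  pos x = toℕ (π ⟨$⟩ˡ x)

  pos-injective : ∀ {x y} → pos x ≡ pos y → x ≡ y
  pos-injective = permutation-injective (flip π) ∘ FinP.toℕ-injective

  home : Fin n → ℕ
  home x = toℕ x + n

  home-injective : ∀ {x y} → home x ≡ home y → x ≡ y
  home-injective = FinP.toℕ-injective ∘ +-cancelʳ-≡ n _ _

  key : ℕ → Fin n → ℕ
  key d x = home x ⊓ (pos x + d)

  place : ℕ → Fin n → ℕ × ℕ
  place d x = key d x , pos x

  _≺[_]_ : Fin n → ℕ → Fin n → Set
  y ≺[ d ] x = place d y <ₗ place d x

  module Arrangement (d : ℕ) = Ranking ℕ²-lex (place d) (pos-injective ∘ proj₂)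
  open Arrangement using (rank; rankPerm; toℕ-rankPerm; rank-by-permutation)

  -- At time d the travelling value u reaches the position of a smaller value v that
  -- is already at home although it comes later in π: an inversion of π.
  Meeting : ℕ → Set
  Meeting d = ∃₂ λ u v → toℕ v < toℕ u × pos u < pos v × home v ≡ pos u + d

  meeting? : ∀ d → Dec (Meeting d)
  meeting? d = FinP.any? λ u → FinP.any? λ v →
    (toℕ v <? toℕ u) ×-dec (pos u <? pos v) ×-dec (home v ≟ pos u + d)

  Settled Moving : ℕ → Fin n → Set
  Settled d x = home x ≤ pos x + d
  Moving  d x = pos x + d < home x

  settled-later : ∀ {d x} → Settled d x → Settled (suc d) x
  settled-later {d} {x} sx = ≤-trans sx (+-monoʳ-≤ (pos x) (n≤1+n d))

  key-settled : ∀ {d x} → Settled d x → key d x ≡ home x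
  key-settled = m≤n⇒m⊓n≡m

  key-moving : ∀ {d x} → Moving d x → key d x ≡ pos x + d
  key-moving = m≥n⇒m⊓n≡n ∘ <⇒≤

  key-moving-suc : ∀ {d x} → Moving d x → key (suc d) x ≡ suc (key d x)
  key-moving-suc {d} {x} mx = begin
    home x ⊓ (pos x + suc d)  ≡⟨ m≥n⇒m⊓n≡n (≤-trans (≤-reflexive (+-suc (pos x) d)) mx) ⟩
    pos x + suc d             ≡⟨ +-suc (pos x) d ⟩
    suc (pos x + d)           ≡⟨ cong suc (key-moving mx) ⟨
    suc (key d x)             ∎
    where open ≡-Reasoning

  key-step : ∀ d y → key d y ≤ key (suc d) y × key (suc d) y ≤ suc (key d y)
  key-step d y with ≤-<-connex (home y) (pos y + d)
  ... | inj₁ sy = let same = trans (key-settled (settled-later sy)) (sym (key-settled sy))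
                  in ≤-reflexive (sym same) , ≤-trans (≤-reflexive same) (n≤1+n _)
  ... | inj₂ my = let up = key-moving-suc my in ≤-trans (n≤1+n _) (≤-reflexive (sym up)) , ≤-reflexive up

  at : ∀ {d y x a b} → key d y ≡ a → key d x ≡ b → y ≺[ d ] x → (a , pos y) <ₗ (b , pos x)
  at {y = y} {x} ky kx = subst₂ (λ a b → (a , pos y) <ₗ (b , pos x)) ky kx

  at⁻ : ∀ {d y x a b} → key d y ≡ a → key d x ≡ b → (a , pos y) <ₗ (b , pos x) → y ≺[ d ] x
  at⁻ {y = y} {x} ky kx = subst₂ (λ a b → (a , pos y) <ₗ (b , pos x)) (sym ky) (sym kx)

  moving-keeps : ∀ {d x y} → Moving d x → y ≺[ d ] x → y ≺[ suc d ] x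
  moving-keeps {d} {x} {y} mx y≺x = at⁻ refl (key-moving-suc mx) (lex-raise y≺x (proj₂ (key-step d y)))

  moving-gains : ∀ {d x y} → Moving d x → y ≺[ suc d ] x → ¬ y ≺[ d ] x → home y ≡ pos x + d × Meeting d
  moving-gains {d} {x} {y} mx y≺′x y⊀x with ≤-<-connex (home y) (pos y + d)
  ... | inj₂ my = ⊥-elim (y⊀x (lex-suc⁻ (at (key-moving-suc my) (key-moving-suc mx) y≺′x)))
  ... | inj₁ sy with lex-gained (at (key-settled (settled-later sy)) (key-moving-suc mx) y≺′x)
                                (y⊀x ∘ at⁻ (key-settled sy) refl)
  ...   | inj₁ (hy≡kx , py≮px) = hy≡px+d , x , y , +-cancelʳ-< n _ _ (subst (_< home x) (sym hy≡px+d) mx) ,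
                                 ≤∧≢⇒< (≮⇒≥ py≮px) (λ px≡py → <⇒≱ mx (subst (Settled d) (pos-injective (sym px≡py)) sy)) ,
                                 hy≡px+d
    where
    hy≡px+d : home y ≡ pos x + d
    hy≡px+d = trans hy≡kx (key-moving mx)
  ...   | inj₂ (hy≡1+kx , py<px) = ⊥-elim (<-irrefl hy≡1+kx (begin-strict
          home y         ≤⟨ sy ⟩
          pos y + d      <⟨ +-monoˡ-< d py<px ⟩
          pos x + d      ≡⟨ key-moving mx ⟨
          key d x        <⟨ n<1+n _ ⟩
          suc (key d x)  ∎))
    where open ≤-Reasoning

  settled-keeps : ∀ {d x y} → Settled d x → y ≺[ suc d ] x → y ≺[ d ] x
  settled-keeps {d} {x} {y} sx y≺′x =
    at⁻ refl (key-settled sx) (lex-lower (at refl (key-settled (settled-later sx)) y≺′x) (proj₁ (key-step d y)))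

  settled-loses : ∀ {d x y} → Settled d x → y ≺[ d ] x → ¬ y ≺[ suc d ] x → pos y + d ≡ home x × Meeting d
  settled-loses {d} {x} {y} sx y≺x y⊀′x with ≤-<-connex (home y) (pos y + d)
  ... | inj₁ sy = ⊥-elim (y⊀′x (at⁻ (key-settled (settled-later sy)) (key-settled (settled-later sx))
                                    (at (key-settled sy) (key-settled sx) y≺x)))
  ... | inj₂ my with lex-lost (at refl (key-settled sx) y≺x)
                              (y⊀′x ∘ at⁻ (key-moving-suc my) (key-settled (settled-later sx)))
  ...   | inj₁ (ky≡hx , py<px) = py+d≡hx , y , x , +-cancelʳ-< n _ _ (subst (_< home y) py+d≡hx my) , py<px , sym py+d≡hx
    where
    py+d≡hx : pos y + d ≡ home x
    py+d≡hx = trans (sym (key-moving my)) ky≡hx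
  ...   | inj₂ (1+ky≡hx , py≮px) = ⊥-elim (<-irrefl (sym 1+ky≡hx) (begin-strict
          home x         ≤⟨ sx ⟩
          pos x + d      ≤⟨ +-monoˡ-≤ d (≮⇒≥ py≮px) ⟩
          pos y + d      ≡⟨ key-moving my ⟨
          key d y        <⟨ n<1+n _ ⟩
          suc (key d y)  ∎))
    where open ≤-Reasoning

  ≺? : ∀ d x → Decidable (_≺[ d ] x)
  ≺? d x y = StrictTotalOrder._<?_ ℕ²-lex (place d y) (place d x)

  rank-step : ∀ d x → Step (Meeting d) (rank d x) (rank (suc d) x) ⊎ Step (Meeting d) (rank (suc d) x) (rank d x)
  rank-step d x with ≤-<-connex (home x) (pos x + d)
  ... | inj₂ mx = inj₁ (count-step (≺? d x) (≺? (suc d) x) (λ _ → moving-keeps mx)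
        (λ y z (y≺′x , y⊀x) (z≺′x , z⊀x) → home-injective
          (trans (proj₁ (moving-gains mx y≺′x y⊀x)) (sym (proj₁ (moving-gains mx z≺′x z⊀x)))))
        (λ y (y≺′x , y⊀x) → proj₂ (moving-gains mx y≺′x y⊀x)))
  ... | inj₁ sx = inj₂ (count-step (≺? (suc d) x) (≺? d x) (λ _ → settled-keeps sx)
        (λ y z (y≺x , y⊀′x) (z≺x , z⊀′x) → pos-injective (+-cancelʳ-≡ d _ _
          (trans (proj₁ (settled-loses sx y≺x y⊀′x)) (sym (proj₁ (settled-loses sx z≺x z⊀′x))))))
        (λ y (y≺x , y⊀′x) → proj₂ (settled-loses sx y≺x y⊀′x)))

  rank-step-≤1 : ∀ d x → ∣ rank (suc d) x - rank d x ∣ ≤ 1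
  rank-step-≤1 d x with rank-step d x
  ... | inj₁ step = subst (_≤ 1) (∣-∣-comm (rank d x) _) (step-≤1 step)
  ... | inj₂ step = step-≤1 step

  rank-still : ∀ d x → ¬ Meeting d → rank (suc d) x ≡ rank d x
  rank-still d x no-meeting with rank-step d x
  ... | inj₁ step = step-still step no-meeting
  ... | inj₂ step = sym (step-still step no-meeting)

  arrangement : ℕ → Permutation′ n
  arrangement = rankPerm

  key-start : ∀ y → key 0 y ≡ pos y
  key-start y = trans (m≥n⇒m⊓n≡n (begin
    pos y + 0    ≡⟨ +-identityʳ (pos y) ⟩
    pos y        ≤⟨ <⇒≤ (FinP.toℕ<n (π ⟨$⟩ˡ y)) ⟩
    n            ≤⟨ m≤n+m n (toℕ y) ⟩
    toℕ y + n    ∎)) (+-identityʳ (pos y))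
    where open ≤-Reasoning

  arrangement-start : ∀ x → arrangement 0 ⟨$⟩ʳ x ≡ π ⟨$⟩ˡ x
  arrangement-start x = FinP.toℕ-injective (trans (toℕ-rankPerm 0 x) (rank-by-permutation 0 (flip π) to from x))
    where
    to : ∀ x y → y ≺[ 0 ] x → pos y < pos x
    to x y (inj₁ lt)      = subst₂ _<_ (key-start y) (key-start x) lt
    to x y (inj₂ (_ , lt)) = lt
    from : ∀ x y → pos y < pos x → y ≺[ 0 ] x
    from x y lt = inj₁ (subst₂ _<_ (sym (key-start y)) (sym (key-start x)) lt)

  key-end : ∀ y → key (n + n) y ≡ home y
  key-end y = key-settled (begin
    toℕ y + n        ≤⟨ +-monoˡ-≤ n (<⇒≤ (FinP.toℕ<n y)) ⟩
    n + n            ≤⟨ m≤n+m (n + n) (pos y) ⟩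
    pos y + (n + n)  ∎)
    where open ≤-Reasoning

  arrangement-end : ∀ x → arrangement (n + n) ⟨$⟩ʳ x ≡ x
  arrangement-end x = FinP.toℕ-injective (trans (toℕ-rankPerm (n + n) x) (rank-by-permutation (n + n) Perm.id to from x))
    where
    to : ∀ x y → y ≺[ n + n ] x → toℕ y < toℕ x
    to x y (inj₁ lt)       = +-cancelʳ-< n _ _ (subst₂ _<_ (key-end y) (key-end x) lt)
    to x y (inj₂ (eq , lt)) = ⊥-elim (<-irrefl (cong pos (home-injective
                                (trans (sym (key-end y)) (trans eq (key-end x))))) lt)
    from : ∀ x y → toℕ y < toℕ x → y ≺[ n + n ] x
    from x y lt = inj₁ (subst₂ _<_ (sym (key-end y)) (sym (key-end x)) (+-monoˡ-< n lt))

  arrangement-still : ∀ d → ¬ Meeting d → arrangement (suc d) ≈ arrangement d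
  arrangement-still d no-meeting x = FinP.toℕ-injective (begin
    toℕ (arrangement (suc d) ⟨$⟩ʳ x)  ≡⟨ toℕ-rankPerm (suc d) x ⟩
    rank (suc d) x                    ≡⟨ rank-still d x no-meeting ⟩
    rank d x                          ≡⟨ toℕ-rankPerm d x ⟨
    toℕ (arrangement d ⟨$⟩ʳ x)        ∎)
    where open ≡-Reasoning

  open Telescope arrangement meeting? arrangement-still public

  transition-bandwidth1 : ∀ d → Bandwidth1 (transition d)
  transition-bandwidth1 d k = subst₂ (λ a b → ∣ a - b ∣ ≤ 1) (sym (toℕ-rankPerm (suc d) x)) rank-x (rank-step-≤1 d x)
    where
    x : Fin n
    x = arrangement d ⟨$⟩ˡ k
    rank-x : rank d x ≡ toℕ k
    rank-x = trans (sym (toℕ-rankPerm d x)) (cong toℕ (inverseʳ (arrangement d)))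

  meetingValue : ℕ → ℤ
  meetingValue d = ℤ.+ d ℤ.- ℤ.+ n

  meetingValue-injective : ∀ {d e} → meetingValue d ≡ meetingValue e → d ≡ e
  meetingValue-injective {d} {e} same = ℤ.+-injective (∙-cancelʳ (ℤ.- ℤ.+ n) (ℤ.+ d) (ℤ.+ e) same)

  meeting-inversion : ∀ {d} → Meeting d → meetingValue d ∈ inversionValues π
  meeting-inversion {d} (u , v , v<u , pos-u<pos-v , home-v) =
    subst (_∈ inversionValues π) value
      (∈-map⁺ _ (∈-filter⁺ _ (∈-cartesianProduct⁺ (∈-allFin i) (∈-allFin j))
        (pos-u<pos-v , subst₂ _<_ (sym (cong toℕ (inverseʳ π))) (sym (cong toℕ (inverseʳ π))) v<u)))
    where
    i j : Fin n
    i = π ⟨$⟩ˡ u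
    j = π ⟨$⟩ˡ v
    value : ℤ.+ toℕ (π ⟨$⟩ʳ j) ℤ.- ℤ.+ toℕ i ≡ meetingValue d
    value = trans (cong (λ w → ℤ.+ toℕ w ℤ.- ℤ.+ toℕ i) (inverseʳ π))
                  (difference-cong {toℕ v} {pos u} {d} {n} (trans home-v (+-comm (pos u) d)))

  layers : List (Permutation′ n)
  layers = map transition (changeTimes (n + n))

  layers-bandwidth1 : All Bandwidth1 layers
  layers-bandwidth1 = All.map⁺ (All.universal transition-bandwidth1 _)

  layers-product : product layers ≈ π
  layers-product i = begin
    product layers ⟨$⟩ʳ i                                ≡⟨ cong (product layers ⟨$⟩ʳ_) start ⟨
    product layers ⟨$⟩ʳ (arrangement 0 ⟨$⟩ʳ (π ⟨$⟩ʳ i))  ≡⟨ telescope (n + n) (π ⟨$⟩ʳ i) ⟩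
    arrangement (n + n) ⟨$⟩ʳ (π ⟨$⟩ʳ i)                 ≡⟨ arrangement-end (π ⟨$⟩ʳ i) ⟩
    π ⟨$⟩ʳ i                                            ∎
    where
    open ≡-Reasoning
    start : arrangement 0 ⟨$⟩ʳ (π ⟨$⟩ʳ i) ≡ i
    start = trans (arrangement-start (π ⟨$⟩ʳ i)) (inverseˡ π)

  -- Distinct meeting times give distinct inversion values, so there are at most m layers.
  layers-length : length layers ≤ distinctInversionValues π
  layers-length = begin
    length layers                                 ≡⟨ length-map transition times ⟩
    length times                                  ≡⟨ length-map meetingValue times ⟨
    length (map meetingValue times)               ≤⟨ unique-⊆⇒length≤ distinct-values inversion-values ⟩
    distinctInversionValues π                     ∎
    where
    open ≤-Reasoning
    times : List ℕ
    times = changeTimes (n + n)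
    distinct-values : Unique (map meetingValue times)
    distinct-values = Unique.map⁺ meetingValue-injective (Unique.filter⁺ meeting? (Unique.downFrom⁺ (n + n)))
    inversion-values : All (_∈ deduplicate ℤ._≟_ (inversionValues π)) (map meetingValue times)
    inversion-values = All.map⁺ (All.map (∈-deduplicate⁺ ℤ._≟_ ∘ meeting-inversion) (All.all-filter meeting? (downFrom (n + n))))

theorem1p1 : (n : ℕ) (π : Permutation′ n) →
    Σ (List (Permutation′ n)) (λ ρs →
      length ρs ≤ distinctInversionValues π × All Bandwidth1 ρs × product ρs ≈ π)
theorem1p1 n π = layers , layers-length , layers-bandwidth1 , layers-product
  where open Sweep π
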